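{- For all positive integers $n,m$ we have $s_{n,m}=k_{n,m}$.
   Context: RK puzzles: for a positive integer $n$ let $I_n=\{1,\dots,n\}$ and $I_{n,m}=I_n\times I_m\subset\mathbb{R}^2$ (first coordinate horizontal). For a slope $s\in\mathbb{Q}\cup\{\infty\}$ let $\mathscr{L}_s$ be the set of lines of slope $s$ meeting $I_{n,m}$, and for $\ell\in\mathscr{L}_s$ let $P_{\ell,s}(X)=\sum_{(i,j)\in\ell\cap I_{n,m}}X_{i,j}$. An $n\times m$ RK puzzle with finite slope set $T$ is a system consisting of one equation $P_{\ell,t}(X)=c_{\ell,t}$ (arbitrary $c_{\ell,t}\in\mathbb{R}$) for each $t\in T$, $\ell\in\mathscr{L}_t$; solutions are real solutions; solvable means having a solution. A set of entries $X_{i,j}$ is uniquely solvable if all solutions agree on each of them. Slope order: $S=\mathbb{Z}\cup\{1/k:k\in\mathbb{Z}\}$ with $1/0:=\infty$, totally ordered by $0\prec\infty\prec-1\prec1\prec-\frac12\prec-2\prec\frac12\prec2\prec-\frac13\prec-3\prec\frac13\prec3\prec\cdots$ (after $0,\infty,-1,1$, for each $k=2,3,\dots$ in turn come $-\frac1k\prec-k\prec\frac1k\prec k$). For $s\in S$, $\mathrm{RK}^s_{n,m}$ is the family of all solvable $n\times m$ RK puzzles with slope set $\{t\in S:t\preceq s\}$. Rows and columns: the $j$-th row of $I_{n,m}$ is $I_n\times\{j\}$, the first and last rows being $j=1$ and $j=m$; the $i$-th column is $\{i\}\times I_m$, the first and last columns being $i=1$ and $i=n$. Invariants: $k_{n,m}$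 is the smallest $s\in S$ (w.r.t. $\prec$) such that every RK puzzle in $\mathrm{RK}^s_{n,m}$ has a unique solution. $r_{n,m}$ (resp. $c_{n,m}$) is the smallest $s\in S$ such that for every RK puzzle in $\mathrm{RK}^{s}_{n,m}$, the first row or the last row (resp. the first column or the last column) is uniquely solvable; $s_{n,m}=\min\{r_{n,m},c_{n,m}\}$ with respect to $\prec$.
   Formalization: The constants $c_{\ell,t}$ and the solutions of the RK puzzles are taken in ℚ instead of ℝ. -}

module Defs where

open import Data.Nat as ℕ using (ℕ; zero; suc; _≤_; _∸_)
open import Data.Integer as ℤ using (ℤ; +_; -_)
open import Data.Rational as ℚ using (ℚ; 0ℚ)
open import Data.Fin using (Fin; toℕ)
open import Data.Product using (Σ; _×_; _,_)
open import Data.Sum using (_⊎_)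
open import Data.Bool using (if_then_else_)
open import Relation.Nullary.Decidable using (⌊_⌋)
open import Relation.Binary.PropositionalEquality using (_≡_)

-- The totally ordered set (S, ≺) is isomorphic to (ℕ, <):
-- the slope of order-rank r is  slopeAt r , given by a primitive direction
-- vector (dx , dy) (slope = dy/dx, with dx = 0 meaning ∞).
--   rank 0 : 0      (1 , 0)
--   rank 1 : ∞      (0 , 1)
--   rank 2 : -1     (1 , -1)
--   rank 3 : 1      (1 , 1)
--   for k = 2,3,… ranks 4(k-2)+4 … 4(k-2)+7 :  -1/k , -k , 1/k , k
-- Hence t ⪯ s iff rank t ≤ rank s, and "smallest s ∈ S" = smallest rank.
block : ℕ → ℕ → ℤ × ℤ
block k 0 = (+ k , - (+ 1))
block k 1 = (+ 1 , - (+ k))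
block k 2 = (+ k , + 1)
block k 3 = (+ 1 , + k)
block k (suc (suc (suc (suc i)))) = block (suc k) i

slopeAt : ℕ → ℤ × ℤ
slopeAt 0 = (+ 1 , + 0)
slopeAt 1 = (+ 0 , + 1)
slopeAt 2 = (+ 1 , - (+ 1))
slopeAt 3 = (+ 1 , + 1)
slopeAt (suc (suc (suc (suc i)))) = block 2 i

-- Grid I_{n,m}: point (i , j) with i : Fin n standing for i+1 (horizontal),
-- j : Fin m standing for j+1 (vertical).
coord : ∀ {n} → Fin n → ℤ
coord i = + suc (toℕ i)

-- Lines of slope with direction (a , b) are the level sets of
-- (x , y) ↦ b·x − a·y ; the line is labelled by this value v ∈ ℤ.
lineVal : ∀ {n m} → ℤ × ℤ → Fin n → Fin m → ℤ
lineVal (a , b) i j = (b ℤ.* coord i) ℤ.- (a ℤ.* coord j)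

sumFin : (k : ℕ) → (Fin k → ℚ) → ℚ
sumFin zero    f = 0ℚ
sumFin (suc k) f = f Fin.zero ℚ.+ sumFin k (λ i → f (Fin.suc i))
  where import Data.Fin as Fin

Grid : ℕ → ℕ → Set
Grid n m = Fin n → Fin m → ℚ

P : ∀ {n m} → ℤ × ℤ → ℤ → Grid n m → ℚ
P {n} {m} d v X =
  sumFin n (λ i → sumFin m (λ j →
    if ⌊ lineVal d i j ℤ.≟ v ⌋ then X i j else 0ℚ))

-- Right-hand sides: c r v is the constant for slope of rank r and line label v.
RHS : Set
RHS = ℕ → ℤ → ℚ

-- X solves the n×m RK puzzle with slope set {t ⪯ slopeAt s} and constants c:
-- one equation for every slope t ⪯ s and every line of that slope meeting I_{n,m}
-- (lines meeting the grid = labels attained at some grid point (i0 , j0)).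
Solves : (n m : ℕ) → ℕ → RHS → Grid n m → Set
Solves n m s c X =
  ∀ t → t ≤ s → ∀ (i0 : Fin n) (j0 : Fin m) →
    let v = lineVal (slopeAt t) i0 j0 in P (slopeAt t) v X ≡ c t v

Solvable : (n m : ℕ) → ℕ → RHS → Set
Solvable n m s c = Σ (Grid n m) (Solves n m s c)

UniqueSol : (n m : ℕ) → ℕ → RHS → Set
UniqueSol n m s c = ∀ X Y → Solves n m s c X → Solves n m s c Y →
  ∀ i j → X i j ≡ Y i j

-- the row with index r (0-based: r = 0 first row, r = m ∸ 1 last row) is uniquely solvable
RowUnique : (n m : ℕ) → ℕ → RHS → ℕ → Set
RowUnique n m s c r = ∀ X Y → Solves n m s c X → Solves n m s c Y →
  ∀ (i : Fin n) (j : Fin m) → toℕ j ≡ r → X i j ≡ Y i j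

ColUnique : (n m : ℕ) → ℕ → RHS → ℕ → Set
ColUnique n m s c r = ∀ X Y → Solves n m s c X → Solves n m s c Y →
  ∀ (i : Fin n) (j : Fin m) → toℕ i ≡ r → X i j ≡ Y i j

K : ℕ → ℕ → ℕ → Set
K n m s = ∀ c → Solvable n m s c → UniqueSol n m s c

R : ℕ → ℕ → ℕ → Set
R n m s = ∀ c → Solvable n m s c → RowUnique n m s c 0 ⊎ RowUnique n m s c (m ∸ 1)

C : ℕ → ℕ → ℕ → Set
C n m s = ∀ c → Solvable n m s c → ColUnique n m s c 0 ⊎ ColUnique n m s c (n ∸ 1)

IsLeast : (ℕ → Set) → ℕ → Set
IsLeast Q s = Q s × (∀ t → Q t → s ≤ t)

-- k_{n,m}, r_{n,m}, c_{n,m}, s_{n,m} as relations "x is the value of the invariant"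
IsK : ℕ → ℕ → ℕ → Set
IsK n m = IsLeast (K n m)

IsR : ℕ → ℕ → ℕ → Set
IsR n m = IsLeast (R n m)

IsC : ℕ → ℕ → ℕ → Set
IsC n m = IsLeast (C n m)

IsS : ℕ → ℕ → ℕ → Set
IsS n m s = Σ ℕ λ r → Σ ℕ λ c' → IsR n m r × IsC n m c' × s ≡ r ℕ.⊓ c'

module Submission where

-- For a fixed slope set, the solutions of a solvable puzzle form a translate of the kernel of
-- the homogeneous system, so k, r and c are all defined by properties of that kernel.  If every
-- kernel element vanishes on the first row, then the kernel is zero: shifting such an element
-- one row down gives another kernel element (each line sum of the shifted grid is a line sum of
-- the original one), so by induction every row vanishes.  Rotating the grid by a half turn and
-- transposing it reduce the last row and the two outer columns to this case.  Hence for every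
-- slope the properties defining k, r and c are equivalent, and so are their least witnesses.
-- A least witness exists because triviality of the kernel is decidable (Gaussian elimination)
-- and holds for the slope m + 2, whose lines meet the grid in at most one point.

open import Defs
open import Data.Nat using (ℕ; _≤_)
open import Data.Product using (Σ; _×_)

open import Algebra.Bundles using (CommutativeRing)
open import Data.Fin using (Fin; zero; suc; toℕ; fromℕ; fromℕ<; inject₁; opposite; combine; remQuot; _↑ˡ_; _↑ʳ_)
open import Data.Fin.Permutation using (reverse)
open import Data.Fin.Properties
  using ( any?; toℕ<n; toℕ-inject₁; toℕ-injective; toℕ-fromℕ<; toℕ≤pred[n]; opposite-prop; opposite-involutive
        ; punchInᵢ≢i; remQuot-combine; combine-remQuot )
open import Data.Integer as ℤ using (ℤ; +_)
import Data.Integer.Properties as ℤP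
import Data.Integer.Solver as ℤSolver
open import Data.Nat as ℕ using (zero; suc; _<_; _∸_; z≤n; s≤s)
import Data.Nat.Properties as ℕP
open import Data.Nat.DivMod using (_%_; [m+kn]%n≡m%n; m<n⇒m%n≡m)
open import Data.Product using (∃; ∃-syntax; _,_; proj₁; proj₂; swap; uncurry)
open import Data.Rational as ℚ using (ℚ; 0ℚ; 1ℚ; _+_; _*_; -_; _-_; 1/_)
import Data.Rational.Properties as ℚP
import Data.Rational.Solver as ℚSolver
open import Data.Bool using (if_then_else_)
open import Data.Sum using (inj₁; inj₂; [_,_])
open import Data.Vec.Functional using (Vector; _∷_; tail; last; removeAt)
open import Function using (_∘_; flip)
open import Function.Bundles using (_⇔_; mk⇔; module Equivalence)
open import Relation.Nullary using (¬_; Dec; yes; no; ¬?; contradiction)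
open import Relation.Nullary.Decidable using (⌊_⌋; map; decidable-stable)
open import Relation.Unary using (Decidable)
open import Relation.Binary.PropositionalEquality using (_≡_; _≢_; refl; sym; trans; cong; cong₂; subst; module ≡-Reasoning)
open ≡-Reasoning

open import Algebra.Properties.Semiring.Sum (CommutativeRing.semiring ℚP.+-*-commutativeRing)
open import Algebra.Properties.Group ℚP.+-0-group using (x∙y⁻¹≈ε⇒x≈y)

sumFin≡∑ : ∀ k (f : Vector ℚ k) → sumFin k f ≡ ∑[ i < k ] f i
sumFin≡∑ zero    f = refl
sumFin≡∑ (suc k) f = cong (λ t → f zero + t) (sumFin≡∑ k (f ∘ suc))

∑-zero : ∀ {k} (f : Vector ℚ k) → (∀ i → f i ≡ 0ℚ) → ∑[ i < k ] f i ≡ 0ℚ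
∑-zero {k} f f≡0 = trans (sum-cong-≗ f≡0) (sum-replicate-zero k)

∑∑-zero : ∀ {n m} (f : Fin n → Fin m → ℚ) → (∀ i j → f i j ≡ 0ℚ) → ∑[ i < n ] ∑[ j < m ] f i j ≡ 0ℚ
∑∑-zero {m = m} f f≡0 = ∑-zero (λ i → ∑[ j < m ] f i j) (λ i → ∑-zero (f i) (f≡0 i))

∑-single : ∀ {k} (f : Vector ℚ k) i → (∀ j → j ≢ i → f j ≡ 0ℚ) → ∑[ j < k ] f j ≡ f i
∑-single {suc k} f i others = begin
  sum f                     ≡⟨ sum-remove {i = i} f ⟩
  f i + sum (removeAt f i)  ≡⟨ cong (λ t → f i + t) (∑-zero _ (λ j → others _ (punchInᵢ≢i i j))) ⟩
  f i + 0ℚ                  ≡⟨ ℚP.+-identityʳ (f i) ⟩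
  f i                       ∎

∑∑-single : ∀ {n m} (f : Fin n → Fin m → ℚ) i j →
            (∀ i′ j′ → ¬ (i′ ≡ i × j′ ≡ j) → f i′ j′ ≡ 0ℚ) →
            ∑[ i′ < n ] ∑[ j′ < m ] f i′ j′ ≡ f i j
∑∑-single f i j others = trans
  (∑-single _ i (λ i′ i′≢i → ∑-zero _ (λ j′ → others i′ j′ (i′≢i ∘ proj₁))))
  (∑-single _ j (λ j′ j′≢j → others i j′ (j′≢j ∘ proj₂)))

∑-distrib-− : ∀ {k} (f g : Vector ℚ k) → ∑[ i < k ] (f i - g i) ≡ ∑[ i < k ] f i - ∑[ i < k ] g i
∑-distrib-− {zero}  f g = refl
∑-distrib-− {suc k} f g = trans
  (cong (λ t → f zero - g zero + t) (∑-distrib-− (f ∘ suc) (g ∘ suc)))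
  (solve 4 (λ a b c d → (a :- b) :+ (c :- d) := (a :+ c) :- (b :+ d)) refl (f zero) (g zero) _ _)
  where open ℚSolver.+-*-Solver

∑-opposite : ∀ {k} (f : Vector ℚ k) → ∑[ i < k ] f i ≡ ∑[ i < k ] f (opposite i)
∑-opposite f = ∑-permute f reverse

∑-↑ : ∀ a b (f : Vector ℚ (a ℕ.+ b)) →
      ∑[ k < a ℕ.+ b ] f k ≡ ∑[ i < a ] f (i ↑ˡ b) + ∑[ j < b ] f (a ↑ʳ j)
∑-↑ zero    b f = sym (ℚP.+-identityˡ _)
∑-↑ (suc a) b f = trans (cong (λ t → f zero + t) (∑-↑ a b (f ∘ suc))) (sym (ℚP.+-assoc (f zero) _ _))

∑-combine : ∀ n m (f : Vector ℚ (n ℕ.* m)) →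
            ∑[ k < n ℕ.* m ] f k ≡ ∑[ i < n ] ∑[ j < m ] f (combine i j)
∑-combine zero    m f = refl
∑-combine (suc n) m f = trans (∑-↑ m (n ℕ.* m) f)
  (cong (λ t → ∑[ j < m ] f (j ↑ˡ n ℕ.* m) + t) (∑-combine n m (f ∘ (m ↑ʳ_))))

∑-remQuot : ∀ n m (g : Fin n → Fin m → ℚ) →
            ∑[ k < n ℕ.* m ] uncurry g (remQuot {n} m k) ≡ ∑[ i < n ] ∑[ j < m ] g i j
∑-remQuot n m g = trans (∑-combine n m _)
  (sum-cong-≗ (λ i → sum-cong-≗ (λ j → cong (uncurry g) (remQuot-combine i j))))

Direction : Set
Direction = ℤ × ℤ

mask : ℤ → ℤ → ℚ → ℚ
mask x v a = if ⌊ x ℤ.≟ v ⌋ then a else 0ℚ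

mask-on : ∀ {x v} a → x ≡ v → mask x v a ≡ a
mask-on {x} {v} a x≡v with x ℤ.≟ v
... | yes _   = refl
... | no x≢v  = contradiction x≡v x≢v

mask-off : ∀ {x v} a → x ≢ v → mask x v a ≡ 0ℚ
mask-off {x} {v} a x≢v with x ℤ.≟ v
... | yes x≡v = contradiction x≡v x≢v
... | no _    = refl

mask-0 : ∀ x v → mask x v 0ℚ ≡ 0ℚ
mask-0 x v with x ℤ.≟ v
... | yes _ = refl
... | no _  = refl

mask-− : ∀ x v a b → mask x v (a - b) ≡ mask x v a - mask x v b
mask-− x v a b with x ℤ.≟ v
... | yes _ = refl
... | no _  = refl

mask-1* : ∀ x v a → mask x v 1ℚ * a ≡ mask x v a
mask-1* x v a with x ℤ.≟ v
... | yes _ = ℚP.*-identityˡ a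
... | no _  = ℚP.*-zeroˡ a

mask-cancel : ∀ (f g : ℤ → ℤ) → (∀ x → g (f x) ≡ x) → ∀ x v a → mask (f x) (f v) a ≡ mask x v a
mask-cancel f g g∘f x v a with x ℤ.≟ v
... | yes x≡v = mask-on a (cong f x≡v)
... | no x≢v  = mask-off a (λ fx≡fv → x≢v (trans (sym (g∘f x)) (trans (cong g fx≡fv) (g∘f v))))

onLine : ∀ {n m} → Direction → ℤ → Grid n m → Grid n m
onLine d v X i j = mask (lineVal d i j) v (X i j)

P≡∑∑ : ∀ {n m} d v (X : Grid n m) → P d v X ≡ ∑[ i < n ] ∑[ j < m ] onLine d v X i j
P≡∑∑ {n} {m} d v X = trans (sumFin≡∑ n _) (sum-cong-≗ (λ i → sumFin≡∑ m (onLine d v X i)))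

P-− : ∀ {n m} d v (X Y : Grid n m) → P d v (λ i j → X i j - Y i j) ≡ P d v X - P d v Y
P-− {n} {m} d v X Y = begin
  P d v (λ i j → X i j - Y i j)
    ≡⟨ P≡∑∑ d v (λ i j → X i j - Y i j) ⟩
  ∑[ i < n ] ∑[ j < m ] mask (lineVal d i j) v (X i j - Y i j)
    ≡⟨ sum-cong-≗ (λ i → trans (sum-cong-≗ (λ j → mask-− (lineVal d i j) v (X i j) (Y i j)))
                               (∑-distrib-− (X̂ i) (Ŷ i))) ⟩
  ∑[ i < n ] (∑[ j < m ] X̂ i j - ∑[ j < m ] Ŷ i j)
    ≡⟨ ∑-distrib-− (λ i → ∑[ j < m ] X̂ i j) (λ i → ∑[ j < m ] Ŷ i j) ⟩
  ∑[ i < n ] ∑[ j < m ] X̂ i j - ∑[ i < n ] ∑[ j < m ] Ŷ i j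
    ≡⟨ cong₂ _-_ (P≡∑∑ d v X) (P≡∑∑ d v Y) ⟨
  P d v X - P d v Y
    ∎
  where
  X̂ Ŷ : Grid n m
  X̂ = onLine d v X
  Ŷ = onLine d v Y

P-absent : ∀ {n m} d v (X : Grid n m) → (∀ i j → lineVal d i j ≢ v) → P d v X ≡ 0ℚ
P-absent d v X off = trans (P≡∑∑ d v X) (∑∑-zero (onLine d v X) (λ i j → mask-off (X i j) (off i j)))

zeroGrid : ∀ {n m} → Grid n m
zeroGrid _ _ = 0ℚ

P-zero : ∀ {n m} d v → P {n} {m} d v zeroGrid ≡ 0ℚ
P-zero {n} {m} d v = trans (P≡∑∑ {n} {m} d v zeroGrid)
  (∑∑-zero (onLine {n} {m} d v zeroGrid) (λ i j → mask-0 (lineVal d i j) v))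

-- Kernels of line sums over a set of directions

Kernel : ∀ {n m} → (Direction → Set) → Grid n m → Set
Kernel D Z = ∀ d → D d → ∀ v → P d v Z ≡ 0ℚ

OnlyZero : ℕ → ℕ → (Direction → Set) → Set
OnlyZero n m D = ∀ (Z : Grid n m) → Kernel D Z → ∀ i j → Z i j ≡ 0ℚ

RowVanishes : ∀ {n m} → ℕ → Grid n m → Set
RowVanishes r Z = ∀ i j → toℕ j ≡ r → Z i j ≡ 0ℚ

ColumnVanishes : ∀ {n m} → ℕ → Grid n m → Set
ColumnVanishes r Z = ∀ i j → toℕ i ≡ r → Z i j ≡ 0ℚ

lineVal-swap : ∀ {n m} d (i : Fin n) (j : Fin m) → lineVal (swap d) j i ≡ ℤ.- lineVal d i j
lineVal-swap (a , b) i j =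
  solve 4 (λ a b x y → a :* y :- b :* x := :- (b :* x :- a :* y)) refl a b (coord i) (coord j)
  where open ℤSolver.+-*-Solver

P-flip : ∀ {n m} d v (Z : Grid n m) → P d v (flip Z) ≡ P (swap d) (ℤ.- v) Z
P-flip {n} {m} d v Z = begin
  P d v (flip Z)                                                     ≡⟨ P≡∑∑ d v (flip Z) ⟩
  ∑[ j < m ] ∑[ i < n ] mask (lineVal d j i) v (Z i j)               ≡⟨ ∑-comm (λ i j → mask (lineVal d j i) v (Z i j)) ⟨
  ∑[ i < n ] ∑[ j < m ] mask (lineVal d j i) v (Z i j)               ≡⟨ sum-cong-≗ (λ i → sum-cong-≗ (relabel i)) ⟩
  ∑[ i < n ] ∑[ j < m ] mask (lineVal (swap d) i j) (ℤ.- v) (Z i j)  ≡⟨ P≡∑∑ (swap d) (ℤ.- v) Z ⟨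
  P (swap d) (ℤ.- v) Z                                               ∎
  where
  relabel : ∀ i j → mask (lineVal d j i) v (Z i j) ≡ mask (lineVal (swap d) i j) (ℤ.- v) (Z i j)
  relabel i j = begin
    mask (lineVal d j i) v (Z i j)               ≡⟨ mask-cancel ℤ.-_ ℤ.-_ ℤP.neg-involutive (lineVal d j i) v (Z i j) ⟨
    mask (ℤ.- lineVal d j i) (ℤ.- v) (Z i j)     ≡⟨ cong (λ x → mask x (ℤ.- v) (Z i j)) (lineVal-swap d j i) ⟨
    mask (lineVal (swap d) i j) (ℤ.- v) (Z i j)  ∎

Kernel-flip : ∀ {n m D} (Z : Grid n m) → Kernel D Z → Kernel (D ∘ swap) (flip Z)
Kernel-flip Z kZ d Dd v = trans (P-flip d v Z) (kZ (swap d) Dd (ℤ.- v))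

rotate : ∀ {n m} → Grid n m → Grid n m
rotate Z i j = Z (opposite i) (opposite j)

coord-opposite : ∀ {n} (i : Fin n) → coord (opposite i) ℤ.+ coord i ≡ + suc n
coord-opposite {n} i = begin
  + (suc (toℕ (opposite i)) ℕ.+ suc (toℕ i))  ≡⟨ cong (λ k → + suc (k ℕ.+ suc (toℕ i))) (opposite-prop i) ⟩
  + suc ((n ∸ suc (toℕ i)) ℕ.+ suc (toℕ i))   ≡⟨ cong (λ k → + suc k) (ℕP.m∸n+n≡m (toℕ<n i)) ⟩
  + suc n                                     ∎

rotationShift : ℕ → ℕ → Direction → ℤ
rotationShift n m (a , b) = b ℤ.* + suc n ℤ.- a ℤ.* + suc m

lineVal-rotate : ∀ {n m} d (i : Fin n) (j : Fin m) →
                 lineVal d (opposite i) (opposite j) ≡ rotationShift n m d ℤ.- lineVal d i j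
lineVal-rotate {n} {m} (a , b) i j = begin
  b ℤ.* x′ ℤ.- a ℤ.* y′
    ≡⟨ solve 6 (λ a b x x′ y y′ → b :* x′ :- a :* y′ := (b :* (x′ :+ x) :- a :* (y′ :+ y)) :- (b :* x :- a :* y))
               refl a b x x′ y y′ ⟩
  (b ℤ.* (x′ ℤ.+ x) ℤ.- a ℤ.* (y′ ℤ.+ y)) ℤ.- (b ℤ.* x ℤ.- a ℤ.* y)
    ≡⟨ cong₂ (λ N M → (b ℤ.* N ℤ.- a ℤ.* M) ℤ.- (b ℤ.* x ℤ.- a ℤ.* y)) (coord-opposite i) (coord-opposite j) ⟩
  rotationShift n m (a , b) ℤ.- lineVal (a , b) i j
    ∎
  where
  open ℤSolver.+-*-Solver
  x x′ y y′ : ℤ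
  x  = coord i
  x′ = coord (opposite i)
  y  = coord j
  y′ = coord (opposite j)

P-rotate : ∀ {n m} d v (Z : Grid n m) → P d v (rotate Z) ≡ P d (rotationShift n m d ℤ.- v) Z
P-rotate {n} {m} d v Z = begin
  P d v (rotate Z)
    ≡⟨ P≡∑∑ d v (rotate Z) ⟩
  ∑[ i < n ] ∑[ j < m ] mask (lineVal d i j) v (Z (opposite i) (opposite j))
    ≡⟨ sum-cong-≗ (λ i → sum-cong-≗ (relabel i)) ⟩
  ∑[ i < n ] ∑[ j < m ] mask (lineVal d (opposite i) (opposite j)) w (Z (opposite i) (opposite j))
    ≡⟨ trans (sum-cong-≗ (λ i → ∑-opposite (λ j → mask (lineVal d i j) w (Z i j))))
             (∑-opposite (λ i → ∑[ j < m ] mask (lineVal d i (opposite j)) w (Z i (opposite j)))) ⟨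
  ∑[ i < n ] ∑[ j < m ] mask (lineVal d i j) w (Z i j)
    ≡⟨ P≡∑∑ d w Z ⟨
  P d w Z
    ∎
  where
  open ℤSolver.+-*-Solver
  c w : ℤ
  c = rotationShift n m d
  w = c ℤ.- v
  relabel : ∀ i j → mask (lineVal d i j) v (Z (opposite i) (opposite j))
                  ≡ mask (lineVal d (opposite i) (opposite j)) w (Z (opposite i) (opposite j))
  relabel i j = begin
    mask (lineVal d i j) v _
      ≡⟨ mask-cancel (λ x → c ℤ.- x) (λ x → c ℤ.- x) (λ x → solve 2 (λ c x → c :- (c :- x) := x) refl c x) _ v _ ⟨
    mask (c ℤ.- lineVal d i j) w _
      ≡⟨ cong (λ x → mask x w _) (lineVal-rotate d i j) ⟨
    mask (lineVal d (opposite i) (opposite j)) w _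
      ∎

Kernel-rotate : ∀ {n m D} (Z : Grid n m) → Kernel D Z → Kernel D (rotate Z)
Kernel-rotate {n} {m} Z kZ d Dd v = trans (P-rotate d v Z) (kZ d Dd (rotationShift n m d ℤ.- v))

dropFirst : ∀ {k} → Vector ℚ (suc k) → Vector ℚ (suc k)
dropFirst {zero}  w _       = 0ℚ
dropFirst {suc k} w zero    = w (suc zero)
dropFirst {suc k} w (suc j) = dropFirst (tail w) j

dropFirst-inject₁ : ∀ {k} (w : Vector ℚ (suc k)) (j : Fin k) → dropFirst w (inject₁ j) ≡ w (suc j)
dropFirst-inject₁ w zero    = refl
dropFirst-inject₁ w (suc j) = dropFirst-inject₁ (tail w) j

dropFirst-last : ∀ {k} (w : Vector ℚ (suc k)) → last (dropFirst w) ≡ 0ℚ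
dropFirst-last {zero}  w = refl
dropFirst-last {suc k} w = dropFirst-last (tail w)

dropFirstRow : ∀ {n k} → Grid n (suc k) → Grid n (suc k)
dropFirstRow Z i = dropFirst (Z i)

lineVal-suc : ∀ {n m} d (i : Fin n) (j : Fin m) → lineVal d i (suc j) ≡ lineVal d i (inject₁ j) ℤ.- proj₁ d
lineVal-suc (a , b) i j = begin
  b ℤ.* coord i ℤ.- a ℤ.* (+ 1 ℤ.+ + suc (toℕ j))
    ≡⟨ solve 4 (λ a b x y → b :* x :- a :* (con (+ 1) :+ y) := (b :* x :- a :* y) :- a) refl a b (coord i) (+ suc (toℕ j)) ⟩
  (b ℤ.* coord i ℤ.- a ℤ.* + suc (toℕ j)) ℤ.- a
    ≡⟨ cong (λ t → (b ℤ.* coord i ℤ.- a ℤ.* + suc t) ℤ.- a) (toℕ-inject₁ j) ⟨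
  lineVal (a , b) i (inject₁ j) ℤ.- a
    ∎
  where open ℤSolver.+-*-Solver

P-dropFirstRow : ∀ {n k} d v (Z : Grid n (suc k)) → RowVanishes 0 Z →
                 P d v (dropFirstRow Z) ≡ P d (v ℤ.- proj₁ d) Z
P-dropFirstRow {n} {k} d v Z first = begin
  P d v (dropFirstRow Z)                                              ≡⟨ P≡∑∑ d v (dropFirstRow Z) ⟩
  ∑[ i < n ] ∑[ j < suc k ] mask (lineVal d i j) v (dropFirst (Z i) j) ≡⟨ sum-cong-≗ row ⟩
  ∑[ i < n ] ∑[ j < suc k ] mask (lineVal d i j) w (Z i j)             ≡⟨ P≡∑∑ d w Z ⟨
  P d w Z                                                             ∎
  where
  open ℤSolver.+-*-Solver
  a w : ℤ
  a = proj₁ d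
  w = v ℤ.- a
  row : ∀ i → ∑[ j < suc k ] mask (lineVal d i j) v (dropFirst (Z i) j) ≡ ∑[ j < suc k ] mask (lineVal d i j) w (Z i j)
  row i = begin
    ∑[ j < suc k ] mask (lineVal d i j) v (dropFirst (Z i) j)
      ≡⟨ sum-init-last (λ j → mask (lineVal d i j) v (dropFirst (Z i) j)) ⟩
    ∑[ j < k ] mask (lineVal d i (inject₁ j)) v (dropFirst (Z i) (inject₁ j))
      + mask (lineVal d i (fromℕ k)) v (last (dropFirst (Z i)))
      ≡⟨ cong₂ _+_ (sum-cong-≗ shifted) (trans (cong (mask _ v) (dropFirst-last (Z i))) (mask-0 _ v)) ⟩
    ∑[ j < k ] mask (lineVal d i (suc j)) w (Z i (suc j)) + 0ℚ
      ≡⟨ ℚP.+-comm (∑[ j < k ] mask (lineVal d i (suc j)) w (Z i (suc j))) 0ℚ ⟩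
    0ℚ + ∑[ j < k ] mask (lineVal d i (suc j)) w (Z i (suc j))
      ≡⟨ cong (λ t → t + ∑[ j < k ] mask (lineVal d i (suc j)) w (Z i (suc j)))
              (trans (cong (mask (lineVal {m = suc k} d i zero) w) (first i zero refl)) (mask-0 (lineVal {m = suc k} d i zero) w)) ⟨
    ∑[ j < suc k ] mask (lineVal d i j) w (Z i j)
      ∎
    where
    shifted : ∀ j → mask (lineVal d i (inject₁ j)) v (dropFirst (Z i) (inject₁ j)) ≡ mask (lineVal d i (suc j)) w (Z i (suc j))
    shifted j = begin
      mask (lineVal d i (inject₁ j)) v (dropFirst (Z i) (inject₁ j))
        ≡⟨ cong (mask _ v) (dropFirst-inject₁ (Z i) j) ⟩
      mask (lineVal d i (inject₁ j)) v (Z i (suc j))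
        ≡⟨ mask-cancel (ℤ._- a) (ℤ._+ a) (λ x → solve 2 (λ x a → (x :- a) :+ a := x) refl x a)
                       (lineVal d i (inject₁ j)) v (Z i (suc j)) ⟨
      mask (lineVal d i (inject₁ j) ℤ.- a) w (Z i (suc j))
        ≡⟨ cong (λ x → mask x w _) (lineVal-suc d i j) ⟨
      mask (lineVal d i (suc j)) w (Z i (suc j))
        ∎

Kernel-dropFirstRow : ∀ {n k D} (Z : Grid n (suc k)) → Kernel D Z → RowVanishes 0 Z → Kernel D (dropFirstRow Z)
Kernel-dropFirstRow Z kZ first d Dd v = trans (P-dropFirstRow d v Z first) (kZ d Dd (v ℤ.- proj₁ d))

firstRow⇒onlyZero : ∀ {n k D} → (∀ (Z : Grid n (suc k)) → Kernel D Z → RowVanishes 0 Z) → OnlyZero n (suc k) D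
firstRow⇒onlyZero {n} {k} {D} first Z kZ i j = rowVanishes (toℕ j) Z kZ i j refl
  where
  rowVanishes : ∀ r (Z : Grid n (suc k)) → Kernel D Z → RowVanishes r Z
  rowVanishes zero    Z kZ = first Z kZ
  rowVanishes (suc r) Z kZ i (suc j) 1+j≡1+r = begin
    Z i (suc j)                   ≡⟨ dropFirst-inject₁ (Z i) j ⟨
    dropFirstRow Z i (inject₁ j)  ≡⟨ rowVanishes r (dropFirstRow Z) (Kernel-dropFirstRow Z kZ (first Z kZ)) i (inject₁ j)
                                                  (trans (toℕ-inject₁ j) (ℕP.suc-injective 1+j≡1+r)) ⟩
    0ℚ                            ∎

lastRow⇒onlyZero : ∀ {n k D} → (∀ (Z : Grid n (suc k)) → Kernel D Z → RowVanishes k Z) → OnlyZero n (suc k) D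
lastRow⇒onlyZero {n} {k} {D} lastRow = firstRow⇒onlyZero first
  where
  first : ∀ (Z : Grid n (suc k)) → Kernel D Z → RowVanishes 0 Z
  first Z kZ i j j≡0 = begin
    Z i j                               ≡⟨ cong₂ Z (opposite-involutive i) (opposite-involutive j) ⟨
    rotate Z (opposite i) (opposite j)  ≡⟨ lastRow (rotate Z) (Kernel-rotate Z kZ) (opposite i) (opposite j)
                                                   (trans (opposite-prop j) (cong (k ∸_) j≡0)) ⟩
    0ℚ                                  ∎

column⇒row : ∀ {n m r D} → (∀ (Z : Grid n m) → Kernel D Z → ColumnVanishes r Z) →
             ∀ (W : Grid m n) → Kernel (D ∘ swap) W → RowVanishes r W
column⇒row column W kW j i = column (flip W) (Kernel-flip W kW) i j

onlyZero-flip : ∀ {n m D} → OnlyZero m n (D ∘ swap) → OnlyZero n m D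
onlyZero-flip onlyZero Z kZ i j = onlyZero (flip Z) (Kernel-flip Z kZ) j i

firstColumn⇒onlyZero : ∀ {k m D} → (∀ (Z : Grid (suc k) m) → Kernel D Z → ColumnVanishes 0 Z) → OnlyZero (suc k) m D
firstColumn⇒onlyZero column = onlyZero-flip (firstRow⇒onlyZero (column⇒row column))

lastColumn⇒onlyZero : ∀ {k m D} → (∀ (Z : Grid (suc k) m) → Kernel D Z → ColumnVanishes k Z) → OnlyZero (suc k) m D
lastColumn⇒onlyZero column = onlyZero-flip (lastRow⇒onlyZero (column⇒row column))

UpTo : ℕ → Direction → Set
UpTo s d = ∃[ t ] t ≤ s × slopeAt t ≡ d

zeroRHS : RHS
zeroRHS _ _ = 0ℚ

zeroGrid-solves : ∀ {n m s} → Solves n m s zeroRHS zeroGrid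
zeroGrid-solves {n} {m} t _ i j = P-zero {n} {m} (slopeAt t) (lineVal (slopeAt t) i j)

homogeneous-solvable : ∀ {n m s} → Solvable n m s zeroRHS
homogeneous-solvable = zeroGrid , zeroGrid-solves

solvesZero⇒Kernel : ∀ {n m s} (Z : Grid n m) → Solves n m s zeroRHS Z → Kernel (UpTo s) Z
solvesZero⇒Kernel Z sZ _ (t , t≤s , refl) v with any? (λ i → any? (λ j → lineVal (slopeAt t) i j ℤ.≟ v))
... | yes (i , j , on)  = subst (λ u → P (slopeAt t) u Z ≡ 0ℚ) on (sZ t t≤s i j)
... | no absent          = P-absent (slopeAt t) v Z (λ i j on → absent (i , j , on))

Kernel⇒solvesZero : ∀ {n m s} (Z : Grid n m) → Kernel (UpTo s) Z → Solves n m s zeroRHS Z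
Kernel⇒solvesZero Z kZ t t≤s i j = kZ (slopeAt t) (t , t≤s , refl) (lineVal (slopeAt t) i j)

solves-difference : ∀ {n m s c} (X Y : Grid n m) → Solves n m s c X → Solves n m s c Y →
                    Solves n m s zeroRHS (λ i j → X i j - Y i j)
solves-difference {c = c} X Y sX sY t t≤s i j = begin
  P d v (λ i j → X i j - Y i j)  ≡⟨ P-− d v X Y ⟩
  P d v X - P d v Y              ≡⟨ cong₂ _-_ (sX t t≤s i j) (sY t t≤s i j) ⟩
  c t v - c t v                  ≡⟨ ℚP.+-inverseʳ (c t v) ⟩
  0ℚ                             ∎
  where
  d : Direction
  d = slopeAt t
  v : ℤ
  v = lineVal d i j

determined⇒vanishes : ∀ {n m s} {Cell : Fin n → Fin m → Set} →
                 (∀ X Y → Solves n m s zeroRHS X → Solves n m s zeroRHS Y → ∀ i j → Cell i j → X i j ≡ Y i j) →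
                 ∀ Z → Kernel (UpTo s) Z → ∀ i j → Cell i j → Z i j ≡ 0ℚ
determined⇒vanishes determined Z kZ = determined Z zeroGrid (Kernel⇒solvesZero Z kZ) zeroGrid-solves

K⇔onlyZero : ∀ {n m s} → K n m s ⇔ OnlyZero n m (UpTo s)
K⇔onlyZero {n} {m} {s} = mk⇔ to from
  where
  to : K n m s → OnlyZero n m (UpTo s)
  to unique Z kZ = unique zeroRHS homogeneous-solvable Z zeroGrid (Kernel⇒solvesZero Z kZ) zeroGrid-solves

  from : OnlyZero n m (UpTo s) → K n m s
  from onlyZero c _ X Y sX sY i j =
    x∙y⁻¹≈ε⇒x≈y (X i j) (Y i j) (onlyZero X−Y (solvesZero⇒Kernel X−Y (solves-difference {c = c} X Y sX sY)) i j)
    where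
    X−Y : Grid n m
    X−Y i j = X i j - Y i j

R⇔onlyZero : ∀ {n k s} → R n (suc k) s ⇔ OnlyZero n (suc k) (UpTo s)
R⇔onlyZero = mk⇔
  (λ rows → [ firstRow⇒onlyZero ∘ determined⇒vanishes , lastRow⇒onlyZero ∘ determined⇒vanishes ]
               (rows zeroRHS homogeneous-solvable))
  (λ onlyZero c sol → inj₁ (λ X Y sX sY i j _ → Equivalence.from K⇔onlyZero onlyZero c sol X Y sX sY i j))

C⇔onlyZero : ∀ {k m s} → C (suc k) m s ⇔ OnlyZero (suc k) m (UpTo s)
C⇔onlyZero = mk⇔
  (λ columns → [ firstColumn⇒onlyZero ∘ determined⇒vanishes , lastColumn⇒onlyZero ∘ determined⇒vanishes ]
                  (columns zeroRHS homogeneous-solvable))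
  (λ onlyZero c sol → inj₁ (λ X Y sX sY i j _ → Equivalence.from K⇔onlyZero onlyZero c sol X Y sX sY i j))

-- Deciding whether a homogeneous system has only the trivial solution

Searchable : Set → Set₁
Searchable A = ∀ {Φ : A → Set} → Decidable Φ → Dec (∃ Φ)

×-searchable : ∀ {A B : Set} → Searchable A → Searchable B → Searchable (A × B)
×-searchable {A} {B} searchA searchB {Φ} Φ? =
  map (mk⇔ pair unpair) (searchA (λ a → searchB (λ b → Φ? (a , b))))
  where
  pair : (∃ λ a → ∃ λ b → Φ (a , b)) → ∃ Φ
  pair (a , b , φ) = (a , b) , φ

  unpair : ∃ Φ → ∃ λ a → ∃ λ b → Φ (a , b)
  unpair ((a , b) , φ) = a , b , φ

module Elimination {Q : Set} (search : Searchable Q) where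

  infix 8 _·_
  _·_ : ∀ {k} → Vector ℚ k → Vector ℚ k → ℚ
  _·_ {k} e x = ∑[ i < k ] (e i * x i)

  Solution : ∀ {k} → (Q → Vector ℚ k) → Vector ℚ k → Set
  Solution E x = ∀ q → E q · x ≡ 0ℚ

  OnlyTrivial : ∀ {k} → (Q → Vector ℚ k) → Set
  OnlyTrivial E = ∀ x → Solution E x → ∀ i → x i ≡ 0ℚ

  module Pivot {k} (E : Q → Vector ℚ (suc k)) (p : Q) (pivot≢0 : E p zero ≢ 0ℚ) where

    private
      B : ℚ
      B = E p zero

      instance
        B-nonZero : ℚ.NonZero B
        B-nonZero = ℚ.≢-nonZero pivot≢0

    ratio : Q → ℚ
    ratio q = E q zero * 1/ B

    reduced : Q → Vector ℚ k
    reduced q j = E q (suc j) - ratio q * E p (suc j)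

    ratio-pivot : ∀ q → ratio q * B ≡ E q zero
    ratio-pivot q = begin
      E q zero * 1/ B * B    ≡⟨ ℚP.*-assoc (E q zero) (1/ B) B ⟩
      E q zero * (1/ B * B)  ≡⟨ cong (E q zero *_) (ℚP.*-inverseˡ B) ⟩
      E q zero * 1ℚ          ≡⟨ ℚP.*-identityʳ _ ⟩
      E q zero               ∎

    pivot-cancel : ∀ {y} → B * y ≡ 0ℚ → y ≡ 0ℚ
    pivot-cancel {y} By≡0 = begin
      y               ≡⟨ ℚP.*-identityˡ y ⟨
      1ℚ * y          ≡⟨ cong (_* y) (ℚP.*-inverseˡ B) ⟨
      1/ B * B * y    ≡⟨ ℚP.*-assoc (1/ B) B y ⟩
      1/ B * (B * y)  ≡⟨ cong (1/ B *_) By≡0 ⟩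
      1/ B * 0ℚ       ≡⟨ ℚP.*-zeroʳ (1/ B) ⟩
      0ℚ              ∎

    reduced-· : ∀ q x → reduced q · tail x ≡ E q · x - ratio q * (E p · x)
    reduced-· q x = begin
      reduced q · tail x
        ≡⟨ sum-cong-≗ (λ j → solve 4 (λ a b r y → (a :- r :* b) :* y := a :* y :- r :* (b :* y)) refl
                                     (E q (suc j)) (E p (suc j)) r (x (suc j))) ⟩
      ∑[ j < k ] (E q (suc j) * x (suc j) - r * (E p (suc j) * x (suc j)))
        ≡⟨ ∑-distrib-− (λ j → E q (suc j) * x (suc j)) (λ j → r * (E p (suc j) * x (suc j))) ⟩
      tail (E q) · tail x - ∑[ j < k ] (r * (E p (suc j) * x (suc j)))
        ≡⟨ cong (λ t → tail (E q) · tail x - t) (*-distribˡ-sum r (λ j → E p (suc j) * x (suc j))) ⟨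
      tail (E q) · tail x - r * (tail (E p) · tail x)
        ≡⟨ solve 5 (λ r b x₀ s t → s :- r :* t := (r :* b :* x₀ :+ s) :- r :* (b :* x₀ :+ t)) refl
                   r B (x zero) (tail (E q) · tail x) (tail (E p) · tail x) ⟩
      (r * B * x zero + tail (E q) · tail x) - r * (E p · x)
        ≡⟨ cong (λ a → (a * x zero + tail (E q) · tail x) - r * (E p · x)) (ratio-pivot q) ⟩
      E q · x - r * (E p · x)
        ∎
      where
      open ℚSolver.+-*-Solver
      r : ℚ
      r = ratio q

    solution⇒reduced : ∀ x → Solution E x → Solution reduced (tail x)
    solution⇒reduced x sol q = begin
      reduced q · tail x             ≡⟨ reduced-· q x ⟩
      E q · x - ratio q * (E p · x)  ≡⟨ cong₂ (λ a c → a - ratio q * c) (sol q) (sol p) ⟩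
      0ℚ - ratio q * 0ℚ              ≡⟨ solve 1 (λ r → con 0ℚ :- r :* con 0ℚ := con 0ℚ) refl (ratio q) ⟩
      0ℚ                             ∎
      where open ℚSolver.+-*-Solver

    extend : Vector ℚ k → Vector ℚ (suc k)
    extend y = (- (tail (E p) · y * 1/ B)) ∷ y

    pivot-extend : ∀ y → E p · extend y ≡ 0ℚ
    pivot-extend y = begin
      B * - (S * 1/ B) + S  ≡⟨ solve 3 (λ b c s → b :* (:- (s :* c)) :+ s := s :* (con 1ℚ :- b :* c)) refl B (1/ B) S ⟩
      S * (1ℚ - B * 1/ B)   ≡⟨ cong (λ u → S * (1ℚ - u)) (ℚP.*-inverseʳ B) ⟩
      S * 0ℚ                ≡⟨ ℚP.*-zeroʳ S ⟩
      0ℚ                    ∎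
      where
      open ℚSolver.+-*-Solver
      S : ℚ
      S = tail (E p) · y

    reduced⇒solution : ∀ y → Solution reduced y → Solution E (extend y)
    reduced⇒solution y sol q = begin
      E q · x
        ≡⟨ solve 3 (λ a r c → a := (a :- r :* c) :+ r :* c) refl (E q · x) (ratio q) (E p · x) ⟩
      (E q · x - ratio q * (E p · x)) + ratio q * (E p · x)
        ≡⟨ cong₂ (λ a c → a + ratio q * c) (trans (sym (reduced-· q x)) (sol q)) (pivot-extend y) ⟩
      0ℚ + ratio q * 0ℚ
        ≡⟨ solve 1 (λ r → con 0ℚ :+ r :* con 0ℚ := con 0ℚ) refl (ratio q) ⟩
      0ℚ
        ∎
      where
      open ℚSolver.+-*-Solver
      x : Vector ℚ (suc k)
      x = extend y

    reduced⇔ : OnlyTrivial reduced ⇔ OnlyTrivial E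
    reduced⇔ = mk⇔ fromReduced toReduced
      where
      fromReduced : OnlyTrivial reduced → OnlyTrivial E
      fromReduced only x sol (suc j) = only (tail x) (solution⇒reduced x sol) j
      fromReduced only x sol zero    = pivot-cancel (begin
        B * x zero                        ≡⟨ ℚP.+-identityʳ _ ⟨
        B * x zero + 0ℚ                   ≡⟨ cong (λ t → B * x zero + t) (∑-zero _ tail-vanishes) ⟨
        E p · x                           ≡⟨ sol p ⟩
        0ℚ                                ∎)
        where
        tail-vanishes : ∀ j → E p (suc j) * x (suc j) ≡ 0ℚ
        tail-vanishes j = trans (cong (E p (suc j) *_) (only (tail x) (solution⇒reduced x sol) j)) (ℚP.*-zeroʳ (E p (suc j)))

      toReduced : OnlyTrivial E → OnlyTrivial reduced
      toReduced only y sol j = only (extend y) (reduced⇒solution y sol) (suc j)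

  onlyTrivial? : ∀ {k} (E : Q → Vector ℚ k) → Dec (OnlyTrivial E)
  onlyTrivial? {zero}  E = yes (λ _ _ ())
  onlyTrivial? {suc k} E with search (λ q → ¬? (E q zero ℚ.≟ 0ℚ))
  ... | yes (p , pivot≢0) = map reduced⇔ (onlyTrivial? reduced)
    where open Pivot E p pivot≢0
  ... | no noPivot = no (λ only → ℚP.1≢0 (only unit unit-solution zero))
    where
    unit : Vector ℚ (suc k)
    unit = 1ℚ ∷ λ _ → 0ℚ

    unit-solution : Solution E unit
    unit-solution q = begin
      E q zero * 1ℚ + ∑[ j < k ] (E q (suc j) * 0ℚ)
        ≡⟨ cong₂ _+_ (trans (ℚP.*-identityʳ (E q zero)) first-column-zero)
                     (∑-zero (λ j → E q (suc j) * 0ℚ) (λ j → ℚP.*-zeroʳ (E q (suc j)))) ⟩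
      0ℚ + 0ℚ
        ≡⟨ ℚP.+-identityʳ 0ℚ ⟩
      0ℚ
        ∎
      where
      first-column-zero : E q zero ≡ 0ℚ
      first-column-zero = decidable-stable (E q zero ℚ.≟ 0ℚ) (λ ≢0 → noPivot (q , ≢0))

PuzzleEquation : ℕ → ℕ → ℕ → Set
PuzzleEquation n m s = Fin (suc s) × Fin n × Fin m

flatten : ∀ {n m} → Grid n m → Vector ℚ (n ℕ.* m)
flatten {n} {m} X k = uncurry X (remQuot {n} m k)

lineThrough : ∀ {n m} → ℕ → Fin n → Fin m → Grid n m
lineThrough t i₀ j₀ i j = mask (lineVal (slopeAt t) i j) (lineVal (slopeAt t) i₀ j₀) 1ℚ

puzzleSystem : ∀ {n m s} → PuzzleEquation n m s → Vector ℚ (n ℕ.* m)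
puzzleSystem (t , i₀ , j₀) = flatten (lineThrough (toℕ t) i₀ j₀)

module _ (n m s : ℕ) where

  open Elimination {PuzzleEquation n m s} (×-searchable any? (×-searchable any? any?))

  ·-flatten : ∀ (t : Fin (suc s)) (i₀ : Fin n) (j₀ : Fin m) (X : Grid n m) →
              puzzleSystem (t , i₀ , j₀) · flatten X ≡ P (slopeAt (toℕ t)) (lineVal (slopeAt (toℕ t)) i₀ j₀) X
  ·-flatten t i₀ j₀ X = trans (∑-remQuot n m (λ i j → lineThrough (toℕ t) i₀ j₀ i j * X i j))
    (trans (sum-cong-≗ (λ i → sum-cong-≗ (λ j → mask-1* _ _ (X i j)))) (sym (P≡∑∑ d (lineVal d i₀ j₀) X)))
    where
    d : Direction
    d = slopeAt (toℕ t)

  onlyTrivial⇔onlyZero : OnlyTrivial puzzleSystem ⇔ OnlyZero n m (UpTo s)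
  onlyTrivial⇔onlyZero = mk⇔ to from
    where
    to : OnlyTrivial puzzleSystem → OnlyZero n m (UpTo s)
    to only Z kZ i j = begin
      Z i j                    ≡⟨ cong (uncurry Z) (remQuot-combine i j) ⟨
      flatten Z (combine i j)  ≡⟨ only (flatten Z) flatten-solution (combine i j) ⟩
      0ℚ                       ∎
      where
      flatten-solution : Solution puzzleSystem (flatten Z)
      flatten-solution (t , i₀ , j₀) =
        trans (·-flatten t i₀ j₀ Z) (kZ _ (toℕ t , toℕ≤pred[n] t , refl) (lineVal (slopeAt (toℕ t)) i₀ j₀))

    from : OnlyZero n m (UpTo s) → OnlyTrivial puzzleSystem
    from onlyZero x sol k = begin
      x k          ≡⟨ cong x (combine-remQuot {n} m k) ⟨
      flatten Z k  ≡⟨ onlyZero Z (solvesZero⇒Kernel Z Z-solves) _ _ ⟩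
      0ℚ           ∎
      where
      Z : Grid n m
      Z i j = x (combine i j)

      Z-solves : Solves n m s zeroRHS Z
      Z-solves t t≤s i₀ j₀ = begin
        P (slopeAt t) (lineVal (slopeAt t) i₀ j₀) Z
          ≡⟨ cong (λ t → P (slopeAt t) (lineVal (slopeAt t) i₀ j₀) Z) (toℕ-fromℕ< (s≤s t≤s)) ⟨
        P (slopeAt (toℕ t′)) (lineVal (slopeAt (toℕ t′)) i₀ j₀) Z
          ≡⟨ ·-flatten t′ i₀ j₀ Z ⟨
        puzzleSystem (t′ , i₀ , j₀) · flatten Z
          ≡⟨ sum-cong-≗ (λ k → cong (puzzleSystem (t′ , i₀ , j₀) k *_) (cong x (combine-remQuot {n} m k))) ⟩
        puzzleSystem (t′ , i₀ , j₀) · x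
          ≡⟨ sol (t′ , i₀ , j₀) ⟩
        0ℚ
          ∎
        where
        t′ : Fin (suc s)
        t′ = fromℕ< (s≤s t≤s)

  onlyZero? : Dec (OnlyZero n m (UpTo s))
  onlyZero? = map onlyTrivial⇔onlyZero (onlyTrivial? puzzleSystem)

-- A slope whose lines meet the grid at most once

integerSlopeRank : ℕ → ℕ
integerSlopeRank p = 7 ℕ.+ p ℕ.* 4

block-integerSlope : ∀ p k → block k (3 ℕ.+ p ℕ.* 4) ≡ (+ 1 , + (p ℕ.+ k))
block-integerSlope zero    k = refl
block-integerSlope (suc p) k = trans (block-integerSlope p (suc k)) (cong (λ u → + 1 , + u) (ℕP.+-suc p k))

slopeAt-integerSlopeRank : ∀ p → slopeAt (integerSlopeRank p) ≡ (+ 1 , + (p ℕ.+ 2))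
slopeAt-integerSlopeRank p = block-integerSlope p 2

digits-unique : ∀ {M a a′ b b′} .{{_ : ℕ.NonZero M}} → b < M → b′ < M →
                b ℕ.+ a ℕ.* M ≡ b′ ℕ.+ a′ ℕ.* M → b ≡ b′ × a ≡ a′
digits-unique {M} {a} {a′} {b} {b′} b<M b′<M eq =
  b≡b′ , ℕP.*-cancelʳ-≡ a a′ M (ℕP.+-cancelˡ-≡ b _ _ (trans eq (cong (ℕ._+ a′ ℕ.* M) (sym b≡b′))))
  where
  b≡b′ : b ≡ b′
  b≡b′ = begin
    b                      ≡⟨ m<n⇒m%n≡m b<M ⟨
    b % M                  ≡⟨ [m+kn]%n≡m%n b a M ⟨
    (b ℕ.+ a ℕ.* M) % M    ≡⟨ cong (_% M) eq ⟩
    (b′ ℕ.+ a′ ℕ.* M) % M  ≡⟨ [m+kn]%n≡m%n b′ a′ M ⟩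
    b′ % M                 ≡⟨ m<n⇒m%n≡m b′<M ⟩
    b′                     ∎

steepLabel-injective : ∀ {n m M} → m < M → ∀ (i i′ : Fin n) (j j′ : Fin m) →
                  lineVal (+ 1 , + M) i j ≡ lineVal (+ 1 , + M) i′ j′ → i ≡ i′ × j ≡ j′
steepLabel-injective {n} {m} {M} m<M i i′ j j′ eq =
  let j′≡j , i≡i′ = digits-unique (coord<M j′) (coord<M j) digits
  in  toℕ-injective (ℕP.suc-injective i≡i′) , toℕ-injective (ℕP.suc-injective (sym j′≡j))
  where
  open ℤSolver.+-*-Solver
  instance
    M-nonZero : ℕ.NonZero M
    M-nonZero = ℕ.>-nonZero (ℕP.≤-<-trans z≤n m<M)

  coord<M : ∀ (j : Fin m) → suc (toℕ j) < M
  coord<M j = ℕP.≤-<-trans (toℕ<n j) m<M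

  ci ci′ cj cj′ : ℕ
  ci  = suc (toℕ i)
  ci′ = suc (toℕ i′)
  cj  = suc (toℕ j)
  cj′ = suc (toℕ j′)

  digits : cj′ ℕ.+ ci ℕ.* M ≡ cj ℕ.+ ci′ ℕ.* M
  digits = ℤP.+-injective (begin
    + cj′ ℤ.+ + (ci ℕ.* M)
      ≡⟨ cong (λ t → + cj′ ℤ.+ t) (ℤP.pos-* ci M) ⟩
    + cj′ ℤ.+ + ci ℤ.* + M
      ≡⟨ solve 4 (λ x y y′ K → y′ :+ x :* K := (K :* x :- con (+ 1) :* y) :+ (y :+ y′))
                 refl (+ ci) (+ cj) (+ cj′) (+ M) ⟩
    lineVal (+ 1 , + M) i j ℤ.+ (+ cj ℤ.+ + cj′)
      ≡⟨ cong (ℤ._+ (+ cj ℤ.+ + cj′)) eq ⟩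
    lineVal (+ 1 , + M) i′ j′ ℤ.+ (+ cj ℤ.+ + cj′)
      ≡⟨ solve 4 (λ x′ y y′ K → (K :* x′ :- con (+ 1) :* y′) :+ (y :+ y′) := y :+ x′ :* K)
                 refl (+ ci′) (+ cj) (+ cj′) (+ M) ⟩
    + cj ℤ.+ + ci′ ℤ.* + M
      ≡⟨ cong (λ t → + cj ℤ.+ t) (ℤP.pos-* ci′ M) ⟨
    + cj ℤ.+ + (ci′ ℕ.* M)
      ∎)

P-steep : ∀ {n m M} → m < M → ∀ (Z : Grid n m) i j → P (+ 1 , + M) (lineVal (+ 1 , + M) i j) Z ≡ Z i j
P-steep {n} {m} {M} m<M Z i j = begin
  P d (lineVal d i j) Z                          ≡⟨ P≡∑∑ d (lineVal d i j) Z ⟩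
  ∑[ i′ < n ] ∑[ j′ < m ] onLine d (lineVal d i j) Z i′ j′  ≡⟨ ∑∑-single (onLine d (lineVal d i j) Z) i j elsewhere ⟩
  mask (lineVal d i j) (lineVal d i j) (Z i j)   ≡⟨ mask-on (Z i j) refl ⟩
  Z i j                                          ∎
  where
  d : Direction
  d = (+ 1 , + M)

  elsewhere : ∀ i′ j′ → ¬ (i′ ≡ i × j′ ≡ j) → onLine d (lineVal d i j) Z i′ j′ ≡ 0ℚ
  elsewhere i′ j′ off = mask-off (Z i′ j′) (off ∘ steepLabel-injective m<M i′ i j′ j)

onlyZero-integerSlope : ∀ n m → OnlyZero n m (UpTo (integerSlopeRank m))
onlyZero-integerSlope n m Z kZ i j = begin
  Z i j                  ≡⟨ P-steep (ℕP.m<m+n m (s≤s z≤n)) Z i j ⟨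
  P d (lineVal d i j) Z  ≡⟨ kZ d (integerSlopeRank m , ℕP.≤-refl , slopeAt-integerSlopeRank m) (lineVal d i j) ⟩
  0ℚ                     ∎
  where
  d : Direction
  d = (+ 1 , + (m ℕ.+ 2))

least : ∀ {Q : ℕ → Set} → Decidable Q → ∀ {N} → Q N → ∃ (IsLeast Q)
least {Q} Q? {N} qN = leastFrom 0 (λ _ ()) N (subst Q (sym (ℕP.+-identityʳ N)) qN)
  where
  leastFrom : ∀ k → (∀ t → t < k → ¬ Q t) → ∀ N → Q (N ℕ.+ k) → ∃ (IsLeast Q)
  leastFrom k below N qN with Q? k
  ... | yes qk = k , qk , λ t qt → ℕP.≮⇒≥ (λ t<k → below t t<k qt)
  leastFrom k below zero    qk | no ¬qk = contradiction qk ¬qk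
  leastFrom k below (suc N) qN | no ¬qk = leastFrom (suc k) below′ N (subst Q (sym (ℕP.+-suc N k)) qN)
    where
    below′ : ∀ t → t < suc k → ¬ Q t
    below′ t t<1+k with ℕP.m<1+n⇒m<n∨m≡n t<1+k
    ... | inj₁ t<k  = below t t<k
    ... | inj₂ refl = ¬qk

IsLeast-⇔ : ∀ {Q Q′ : ℕ → Set} {s} → (∀ {t} → Q t ⇔ Q′ t) → IsLeast Q′ s → IsLeast Q s
IsLeast-⇔ Q⇔Q′ (q′s , minimal) = Equivalence.from Q⇔Q′ q′s , λ t qt → minimal t (Equivalence.to Q⇔Q′ qt)

theorem2 : (n m : ℕ) → 1 ≤ n → 1 ≤ m →
    Σ ℕ λ s → IsS n m s × IsK n m s
theorem2 zero    _       ()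
theorem2 (suc _) zero    _  ()
theorem2 (suc n) (suc m) _  _ =
  s , (s , s , IsLeast-⇔ R⇔onlyZero minimal , IsLeast-⇔ C⇔onlyZero minimal , sym (ℕP.⊓-idem s)) ,
  IsLeast-⇔ K⇔onlyZero minimal
  where
  leastKernelSlope : ∃ (IsLeast (OnlyZero (suc n) (suc m) ∘ UpTo))
  leastKernelSlope = least (onlyZero? (suc n) (suc m)) (onlyZero-integerSlope (suc n) (suc m))

  s : ℕ
  s = proj₁ leastKernelSlope

  minimal : IsLeast (OnlyZero (suc n) (suc m) ∘ UpTo) s
  minimal = proj₂ leastKernelSlope
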